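{- Let $\mathcal{C}$ be a configuration and let $G$ be a nontrivial finite subgroup of the automorphism group $\mathrm{Aut}(\mathcal{C})$. Suppose that some orbit of $\mathrm{Aut}(\mathcal{C})$ on the points of $\mathcal{C}$, or on the lines of $\mathcal{C}$, has cardinality $k$ such that no factor of $|G|$ greater than $1$ divides $k$ (i.e. $\gcd(k,|G|)=1$). Then the orbit space of $\mathcal{C}$ under $G$ is not a configuration.
   Context: A configuration is a pair $(\mathcal{P},\mathcal{L})$ with finitely many points and lines, each line a subset of the points, such that any two distinct points lie on at most one common line, the structure is connected, every point lies on the same number $s$ of lines and every line contains the same number $t$ of points. An automorphism is a bijection of the point set mapping lines onto lines. For a group $G$ of automorphisms, the orbit space has as points the $G$-orbits of points and as lines the $G$-orbits of lines, with incidence induced from representatives; it is said to be a configuration when the quotient map is a covering (all point-fibres have the same cardinality, lines map to lines, incidences are preserved), the quotient is a configuration, and $G$ acts semiregularly (every non-identity element fixes no point and no line). -}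

module Defs where

open import Data.Nat using (ℕ; _<_)
open import Data.Fin using (Fin)
open import Data.List using (List; length)
open import Data.List.Membership.Propositional using (_∈_)
open import Data.List.Relation.Unary.Unique.Propositional using (Unique)
open import Data.List.Relation.Unary.AllPairs using (AllPairs)
open import Data.Product using (Σ; ∃; _×_; _,_)
open import Data.Sum using (_⊎_; inj₁; inj₂)
open import Data.Empty using (⊥)
open import Relation.Nullary using (¬_)
open import Relation.Binary.PropositionalEquality using (_≡_; _≢_)
open import Relation.Binary.Construct.Closure.ReflexiveTransitive using (Star)
open import Data.Nat.Coprimality using (Coprime)

_⟺_ : Set → Set → Set
A ⟺ B = (A → B) × (B → A)

HasSize : {A : Set} → (A → Set) → ℕ → Set
HasSize {A} P n = Σ (List A) λ xs → Unique xs × length xs ≡ n × (∀ a → (a ∈ xs) ⟺ P a)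

Adj : {p l : ℕ} → (Fin p → Fin l → Set) → Fin p ⊎ Fin l → Fin p ⊎ Fin l → Set
Adj I (inj₁ x) (inj₂ j) = I x j
Adj I (inj₂ j) (inj₁ x) = I x j
Adj I (inj₁ _) (inj₁ _) = ⊥
Adj I (inj₂ _) (inj₂ _) = ⊥

record IsConfiguration (p l : ℕ) (I : Fin p → Fin l → Set) : Set where
  field
    s t        : ℕ
    lineExt    : ∀ j j' → (∀ x → I x j ⟺ I x j') → j ≡ j'
    atMostOne  : ∀ x y j j' → x ≢ y → I x j → I y j → I x j' → I y j' → j ≡ j'
    connected  : ∀ a b → Star (Adj I) a b
    pointDeg   : ∀ x → HasSize (λ j → I x j) s
    lineDeg    : ∀ j → HasSize (λ x → I x j) t

record Aut {p l : ℕ} (I : Fin p → Fin l → Set) : Set where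
  field
    σ σ⁻ : Fin p → Fin p
    τ τ⁻ : Fin l → Fin l
    σσ⁻  : ∀ x → σ (σ⁻ x) ≡ x
    σ⁻σ  : ∀ x → σ⁻ (σ x) ≡ x
    ττ⁻  : ∀ j → τ (τ⁻ j) ≡ j
    τ⁻τ  : ∀ j → τ⁻ (τ j) ≡ j
    pres : ∀ x j → I x j ⟺ I (σ x) (τ j)

open Aut public

_≈A_ : {p l : ℕ} {I : Fin p → Fin l → Set} → Aut I → Aut I → Set
g ≈A h = (∀ x → σ g x ≡ σ h x) × (∀ j → τ g j ≡ τ h j)

record FiniteSubgroup {p l : ℕ} (I : Fin p → Fin l → Set) : Set where
  field
    elems    : List (Aut I)
    distinct : AllPairs (λ g h → ¬ (g ≈A h)) elems
    hasId    : ∃ λ e → e ∈ elems × (∀ x → σ e x ≡ x) × (∀ j → τ e j ≡ j)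
    closed   : ∀ g h → g ∈ elems → h ∈ elems →
               ∃ λ k → k ∈ elems × (∀ x → σ k x ≡ σ g (σ h x)) × (∀ j → τ k j ≡ τ g (τ h j))
    inverses : ∀ g → g ∈ elems →
               ∃ λ k → k ∈ elems × (∀ x → σ k x ≡ σ⁻ g x) × (∀ j → τ k j ≡ τ⁻ g j)

open FiniteSubgroup public

order : {p l : ℕ} {I : Fin p → Fin l → Set} → FiniteSubgroup I → ℕ
order G = length (elems G)

AutOrbitP : {p l : ℕ} (I : Fin p → Fin l → Set) → Fin p → Fin p → Set
AutOrbitP I x y = Σ (Aut I) λ α → σ α x ≡ y

AutOrbitL : {p l : ℕ} (I : Fin p → Fin l → Set) → Fin l → Fin l → Set
AutOrbitL I j j' = Σ (Aut I) λ α → τ α j ≡ j'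

GRelP : {p l : ℕ} {I : Fin p → Fin l → Set} → FiniteSubgroup I → Fin p → Fin p → Set
GRelP G x y = ∃ λ g → g ∈ elems G × σ g x ≡ y

GRelL : {p l : ℕ} {I : Fin p → Fin l → Set} → FiniteSubgroup I → Fin l → Fin l → Set
GRelL G j j' = ∃ λ g → g ∈ elems G × τ g j ≡ j'

-- The orbit space is presented by labellings πP, πL of the G-orbits of points / lines
-- (πP x ≡ πP y iff x, y in the same G-orbit; surjective onto the orbit labels), with
-- incidence induced from representatives.
record OrbitSpaceIsConfiguration {p l : ℕ} (I : Fin p → Fin l → Set)
                                 (G : FiniteSubgroup I) : Set where
  field
    np nl    : ℕ
    πP       : Fin p → Fin np
    πL       : Fin l → Fin nl
    πP-surj  : ∀ a → ∃ λ x → πP x ≡ a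
    πL-surj  : ∀ b → ∃ λ j → πL j ≡ b
    πP-orb   : ∀ x y → (πP x ≡ πP y) ⟺ GRelP G x y
    πL-orb   : ∀ j j' → (πL j ≡ πL j') ⟺ GRelL G j j'
  IQ : Fin np → Fin nl → Set
  IQ a b = ∃ λ x → ∃ λ j → πP x ≡ a × πL j ≡ b × I x j
  field
    fibreSize      : ℕ
    fibres         : ∀ a → HasSize (λ x → πP x ≡ a) fibreSize
    -- covering: lines map to lines (points of a line go to distinct orbits)
    linesToLines   : ∀ j x y → I x j → I y j → πP x ≡ πP y → x ≡ y
    incPreserved   : ∀ x j → I x j → IQ (πP x) (πL j)
    quotientConfig : IsConfiguration np nl IQ
    semiregular    : ∀ g → g ∈ elems G → ((∃ λ x → σ g x ≡ x) ⊎ (∃ λ j → τ g j ≡ j)) →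
                     (∀ x → σ g x ≡ x) × (∀ j → τ g j ≡ j)

module Submission where

-- If the orbit space C/G is a configuration, then G acts
-- semiregularly; composing with inverses, two elements of G that agree on a single
-- point (or line) agree everywhere, so G acts freely and EVERY G-orbit of points or
-- lines has exactly |G| elements.  An orbit of the full group Aut(C) is closed under
-- G, hence a disjoint union of G-orbits, so |G| divides its size k.  Then |G| is a
-- common divisor of k and |G|, and coprimality forces |G| = 1, contradicting 1 < |G|.

open import Defs
open import Level using (0ℓ)
open import Data.Nat using (ℕ; suc; _+_; _<_; _≤_; s≤s⁻¹)
open import Data.Nat.Properties using (+-suc; <-≤-trans; ≤-refl; <-irrefl)
open import Data.Nat.Divisibility using (_∣_; ∣-refl; _∣0; ∣m∣n⇒∣m+n)
open import Data.Nat.Coprimality using (Coprime)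
open import Data.Fin using (Fin)
open import Data.Fin.Properties using () renaming (_≟_ to _≟ᶠ_)
open import Data.Product using (∃; _×_; _,_; proj₁; proj₂)
open import Data.Sum using (_⊎_; inj₁; inj₂)
open import Data.List using (List; []; _∷_; length; map; filter)
open import Data.List.Properties using (filter-notAll; length-map)
open import Data.List.Membership.Propositional using (_∈_; find; lose)
open import Data.List.Membership.Propositional.Properties using (∈-filter⁺; ∈-filter⁻; ∈-map⁺; ∈-map⁻)
open import Data.List.Membership.Propositional.Properties.WithK using (unique∧set⇒bag)
open import Data.List.Relation.Binary.BagAndSetEquality using (∼bag⇒↭)
open import Data.List.Relation.Binary.Permutation.Propositional.Properties using (↭-length)
open import Data.List.Relation.Unary.Any using (here; any?)
open import Data.List.Relation.Unary.All using (All; []; _∷_; tabulate)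
open import Data.List.Relation.Unary.AllPairs using (AllPairs; []; _∷_)
open import Data.List.Relation.Unary.Unique.Propositional using (Unique)
import Data.List.Relation.Unary.Unique.Propositional.Properties as Unique
open import Function.Bundles using (_⇔_; mk⇔)
open import Relation.Nullary using (¬_; Dec; yes; no)
open import Relation.Nullary.Decidable using (map′; ¬?)
open import Relation.Binary.Core using (Rel)
open import Relation.Binary.Structures using (IsDecEquivalence)
open import Relation.Binary.PropositionalEquality using (_≡_; refl; sym; trans; cong; subst)
open Relation.Binary.PropositionalEquality.≡-Reasoning

length-filter-split : {X : Set} {P : X → Set} (P? : ∀ x → Dec (P x)) (xs : List X) →
  length xs ≡ length (filter P? xs) + length (filter (λ x → ¬? (P? x)) xs)
length-filter-split P? [] = refl
length-filter-split P? (x ∷ xs) with P? x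
... | yes _ = cong suc (length-filter-split P? xs)
... | no _  = trans (cong suc (length-filter-split P? xs)) (sym (+-suc _ _))

-- Given a decidable equivalence _~_ whose class
-- of every x is enumerated by a duplicate-free list of length n, any duplicate-free
-- list closed under _~_ is a disjoint union of classes, so n divides its length.
module ClassCounting {X : Set} {_~_ : Rel X 0ℓ} (isDecEquivalence : IsDecEquivalence _~_)
  (n : ℕ) (class : X → List X)
  (class-unique : ∀ x → Unique (class x))
  (class-length : ∀ x → length (class x) ≡ n)
  (class-members : ∀ x y → (y ∈ class x) ⟺ (x ~ y)) where

  open IsDecEquivalence isDecEquivalence using (_≟_) renaming (refl to ~-refl; sym to ~-sym; trans to ~-trans)

  Closed : List X → Set
  Closed ys = ∀ {y z} → y ∈ ys → y ~ z → z ∈ ys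

  class-within : ∀ {x} ys → Unique ys → Closed ys → x ∈ ys → length (filter (x ≟_) ys) ≡ n
  class-within {x} ys unique closed x∈ys =
    trans (↭-length (∼bag⇒↭ (unique∧set⇒bag (Unique.filter⁺ (x ≟_) unique) (class-unique x) same)))
          (class-length x)
    where
      same : ∀ {z} → (z ∈ filter (x ≟_) ys) ⇔ (z ∈ class x)
      same {z} = mk⇔
        (λ z∈ → proj₂ (class-members x z) (proj₂ (∈-filter⁻ (x ≟_) {xs = ys} z∈)))
        (λ z∈ → let x~z = proj₁ (class-members x z) z∈ in ∈-filter⁺ (x ≟_) (closed x∈ys x~z) x~z)

  without-class-closed : ∀ x ys → Closed ys → Closed (filter (λ z → ¬? (x ≟ z)) ys)
  without-class-closed x ys closed y∈ y~z with ∈-filter⁻ (λ z → ¬? (x ≟ z)) {xs = ys} y∈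
  ... | y∈ys , x≁y = ∈-filter⁺ (λ z → ¬? (x ≟ z)) (closed y∈ys y~z) (λ x~z → x≁y (~-trans x~z (~-sym y~z)))

  closed-length-divisible : ∀ ys → Unique ys → Closed ys → n ∣ length ys
  closed-length-divisible ys = go (length ys) ys ≤-refl
    where
      go : ∀ fuel ys → length ys ≤ fuel → Unique ys → Closed ys → n ∣ length ys
      go _ [] _ _ _ = n ∣0
      go (suc fuel) (x ∷ xs) bound unique closed =
        subst (n ∣_) (sym (length-filter-split (x ≟_) (x ∷ xs))) (∣m∣n⇒∣m+n class-part rest-part)
        where
          rest : List X
          rest = filter (λ z → ¬? (x ≟ z)) (x ∷ xs)

          class-part : n ∣ length (filter (x ≟_) (x ∷ xs))
          class-part = subst (n ∣_) (sym (class-within (x ∷ xs) unique closed (here refl))) ∣-refl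

          shorter : length rest < suc fuel
          shorter = <-≤-trans (filter-notAll (λ z → ¬? (x ≟ z)) (x ∷ xs) (here (λ ¬x~x → ¬x~x ~-refl))) bound

          rest-part : n ∣ length rest
          rest-part = go fuel rest (s≤s⁻¹ shorter) (Unique.filter⁺ (λ z → ¬? (x ≟ z)) unique)
                         (without-class-closed x (x ∷ xs) closed)

_∘ᴬ_ : {p l : ℕ} {I : Fin p → Fin l → Set} → Aut I → Aut I → Aut I
g ∘ᴬ h = record
  { σ = λ x → σ g (σ h x) ; σ⁻ = λ x → σ⁻ h (σ⁻ g x)
  ; τ = λ j → τ g (τ h j) ; τ⁻ = λ j → τ⁻ h (τ⁻ g j)
  ; σσ⁻ = λ x → trans (cong (σ g) (σσ⁻ h (σ⁻ g x))) (σσ⁻ g x)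
  ; σ⁻σ = λ x → trans (cong (σ⁻ h) (σ⁻σ g (σ h x))) (σ⁻σ h x)
  ; ττ⁻ = λ j → trans (cong (τ g) (ττ⁻ h (τ⁻ g j))) (ττ⁻ g j)
  ; τ⁻τ = λ j → trans (cong (τ⁻ h) (τ⁻τ g (τ h j))) (τ⁻τ h j)
  ; pres = λ x j → (λ i → proj₁ (pres g (σ h x) (τ h j)) (proj₁ (pres h x j) i))
                 , (λ i → proj₂ (pres h x j) (proj₂ (pres g (σ h x) (τ h j)) i))
  }

-- Automorphisms act on points and on lines; both actions are handled at once by
-- indexing over the side of the incidence structure.
data Side : Set where
  points lines : Side

module Actions {p l : ℕ} (I : Fin p → Fin l → Set) where

  Elt : Side → Set
  Elt points = Fin p
  Elt lines  = Fin l

  elt-≟ : (s : Side) → (x y : Elt s) → Dec (x ≡ y)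
  elt-≟ points = _≟ᶠ_
  elt-≟ lines  = _≟ᶠ_

  act : (s : Side) → Aut I → Elt s → Elt s
  act points = σ
  act lines  = τ

  act⁻ : (s : Side) → Aut I → Elt s → Elt s
  act⁻ points = σ⁻
  act⁻ lines  = τ⁻

  act⁻-act : ∀ s g x → act⁻ s g (act s g x) ≡ x
  act⁻-act points = σ⁻σ
  act⁻-act lines  = τ⁻τ

  act-act⁻ : ∀ s g x → act s g (act⁻ s g x) ≡ x
  act-act⁻ points = σσ⁻
  act-act⁻ lines  = ττ⁻

  act-∘ : ∀ s g h x → act s (g ∘ᴬ h) x ≡ act s g (act s h x)
  act-∘ points _ _ _ = refl
  act-∘ lines  _ _ _ = refl

  Agree : Side → Aut I → Aut I → Set
  Agree s g h = ∀ x → act s g x ≡ act s h x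

  Orbit : FiniteSubgroup I → (s : Side) → Elt s → Elt s → Set
  Orbit G s x y = ∃ λ g → g ∈ elems G × act s g x ≡ y

  AutOrbit : (s : Side) → Elt s → Elt s → Set
  AutOrbit s x y = ∃ λ α → act s α x ≡ y

  IsIdentity : Aut I → Set
  IsIdentity e = ∀ s x → act s e x ≡ x

  IsProduct : Aut I → Aut I → Aut I → Set
  IsProduct k g h = ∀ s x → act s k x ≡ act s g (act s h x)

  IsInverse : Aut I → Aut I → Set
  IsInverse k g = ∀ s x → act s k x ≡ act⁻ s g x

  on-both-sides : {P : (s : Side) → Elt s → Set} →
    (∀ x → P points x) → (∀ j → P lines j) → ∀ s x → P s x
  on-both-sides onPoints onLines points = onPoints
  on-both-sides onPoints onLines lines  = onLines

  agree⇒≈A : ∀ {g h} → (∀ s → Agree s g h) → g ≈A h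
  agree⇒≈A agree = agree points , agree lines

  module Subgroup (G : FiniteSubgroup I) where

    identity : ∃ λ e → e ∈ elems G × IsIdentity e
    identity with hasId G
    ... | e , e∈G , eσ , eτ = e , e∈G , on-both-sides eσ eτ

    product : ∀ {g h} → g ∈ elems G → h ∈ elems G → ∃ λ k → k ∈ elems G × IsProduct k g h
    product {g} {h} g∈G h∈G with closed G g h g∈G h∈G
    ... | k , k∈G , kσ , kτ = k , k∈G , on-both-sides kσ kτ

    inverse : ∀ {g} → g ∈ elems G → ∃ λ k → k ∈ elems G × IsInverse k g
    inverse {g} g∈G with inverses G g g∈G
    ... | k , k∈G , kσ , kτ = k , k∈G , on-both-sides kσ kτ

    Semiregular : Set
    Semiregular = ∀ g → g ∈ elems G → ∀ s x → act s g x ≡ x → IsIdentity g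

    semiregular-from-sides :
      (∀ g → g ∈ elems G → ((∃ λ x → σ g x ≡ x) ⊎ (∃ λ j → τ g j ≡ j)) →
             (∀ x → σ g x ≡ x) × (∀ j → τ g j ≡ j)) → Semiregular
    semiregular-from-sides semi g g∈G points x fix =
      let (fσ , fτ) = semi g g∈G (inj₁ (x , fix)) in on-both-sides fσ fτ
    semiregular-from-sides semi g g∈G lines  j fix =
      let (fσ , fτ) = semi g g∈G (inj₂ (j , fix)) in on-both-sides fσ fτ

    orbit-isDecEquivalence : ∀ s → IsDecEquivalence (Orbit G s)
    orbit-isDecEquivalence s = record
      { isEquivalence = record { refl = orbit-refl ; sym = orbit-sym ; trans = orbit-trans }
      ; _≟_ = orbit? }
      where
        orbit-refl : ∀ {x} → Orbit G s x x
        orbit-refl {x} = let (e , e∈G , eid) = identity in e , e∈G , eid s x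

        orbit-sym : ∀ {x y} → Orbit G s x y → Orbit G s y x
        orbit-sym {x} {y} (g , g∈G , gx≡y) = let (k , k∈G , kinv) = inverse g∈G in
          k , k∈G , trans (kinv s y) (trans (cong (act⁻ s g) (sym gx≡y)) (act⁻-act s g x))

        orbit-trans : ∀ {x y z} → Orbit G s x y → Orbit G s y z → Orbit G s x z
        orbit-trans {x} (g , g∈G , gx≡y) (h , h∈G , hy≡z) = let (k , k∈G , kprod) = product h∈G g∈G in
          k , k∈G , trans (kprod s x) (trans (cong (act s h) gx≡y) hy≡z)

        orbit? : ∀ x y → Dec (Orbit G s x y)
        orbit? x y = map′ find (λ (g , g∈G , gx≡y) → lose g∈G gx≡y)
                          (any? (λ g → elt-≟ s (act s g x) y) (elems G))

    -- Freeness.  If g and h agree at one element then h⁻¹g fixes it, so by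
    -- semiregularity h⁻¹g is the identity and g = h as automorphisms.
    free : Semiregular → ∀ {g h} → g ∈ elems G → h ∈ elems G →
           ∀ s x → act s g x ≡ act s h x → g ≈A h
    free semi {g} {h} g∈G h∈G s x gx≡hx with inverse h∈G
    ... | k , k∈G , k-inv with product k∈G g∈G
    ... | m , m∈G , m-prod = agree⇒≈A agree
      where
        m-fixes-x : act s m x ≡ x
        m-fixes-x = begin
          act s m x                ≡⟨ m-prod s x ⟩
          act s k (act s g x)      ≡⟨ cong (act s k) gx≡hx ⟩
          act s k (act s h x)      ≡⟨ k-inv s _ ⟩
          act⁻ s h (act s h x)     ≡⟨ act⁻-act s h x ⟩
          x                        ∎

        m-id : IsIdentity m
        m-id = semi m m∈G s x m-fixes-x

        agree : ∀ t → Agree t g h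
        agree t y = begin
          act t g y                          ≡⟨ sym (act-act⁻ t h _) ⟩
          act t h (act⁻ t h (act t g y))     ≡⟨ cong (act t h) (sym (k-inv t _)) ⟩
          act t h (act t k (act t g y))      ≡⟨ cong (act t h) (sym (m-prod t y)) ⟩
          act t h (act t m y)                ≡⟨ cong (act t h) (m-id t y) ⟩
          act t h y                          ∎

    orbit : ∀ s → Elt s → List (Elt s)
    orbit s x = map (λ g → act s g x) (elems G)

    orbit-members : ∀ s x y → (y ∈ orbit s x) ⟺ Orbit G s x y
    orbit-members s x y =
        (λ y∈ → let (g , g∈G , y≡gx) = ∈-map⁻ (λ g → act s g x) y∈ in g , g∈G , sym y≡gx)
      , (λ (g , g∈G , gx≡y) → subst (_∈ orbit s x) gx≡y (∈-map⁺ (λ g → act s g x) g∈G))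

    -- by freeness, distinct elements of G move x to distinct places, so the
    -- enumeration of an orbit has no repetitions and |G| elements
    orbit-unique : Semiregular → ∀ s x → Unique (orbit s x)
    orbit-unique semi s x = distinct-images (elems G) (tabulate (λ g∈G → g∈G)) (distinct G)
      where
        distinct-images : ∀ gs → All (_∈ elems G) gs → AllPairs (λ g h → ¬ g ≈A h) gs →
                          Unique (map (λ g → act s g x) gs)
        distinct-images [] _ _ = []
        distinct-images (g ∷ gs) (g∈G ∷ gs⊆G) (g≉gs ∷ gs-distinct) =
          differ gs gs⊆G g≉gs ∷ distinct-images gs gs⊆G gs-distinct
          where
            differ : ∀ hs → All (_∈ elems G) hs → All (λ h → ¬ g ≈A h) hs →
                     All (λ y → ¬ act s g x ≡ y) (map (λ h → act s h x) hs)
            differ [] _ _ = []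
            differ (h ∷ hs) (h∈G ∷ hs⊆G) (g≉h ∷ g≉hs) =
              (λ gx≡hx → g≉h (free semi g∈G h∈G s x gx≡hx)) ∷ differ hs hs⊆G g≉hs

    aut-orbit-closed : ∀ s x {y z} → AutOrbit s x y → Orbit G s y z → AutOrbit s x z
    aut-orbit-closed s x (α , αx≡y) (g , _ , gy≡z) =
      g ∘ᴬ α , trans (act-∘ s g α x) (trans (cong (act s g) αx≡y) gy≡z)

    order-divides-aut-orbit : Semiregular → ∀ s x k → HasSize (AutOrbit s x) k → order G ∣ k
    order-divides-aut-orbit semi s x k (ys , unique , length≡k , members) =
      subst (order G ∣_) length≡k (closed-length-divisible ys unique closed-under-G)
      where
        open ClassCounting (orbit-isDecEquivalence s) (order G) (orbit s)
          (orbit-unique semi s) (λ y → length-map (λ g → act s g y) (elems G)) (orbit-members s)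

        closed-under-G : Closed ys
        closed-under-G {y} {z} y∈ys y~z =
          proj₂ (members z) (aut-orbit-closed s x (proj₁ (members y) y∈ys) y~z)

lemma4p4 : (p l : ℕ) (I : Fin p → Fin l → Set) → IsConfiguration p l I →
    (G : FiniteSubgroup I) → 1 < order G →
    (k : ℕ) →
    ((∃ λ x → HasSize (AutOrbitP I x) k) ⊎ (∃ λ j → HasSize (AutOrbitL I j) k)) →
    Coprime k (order G) →
    ¬ OrbitSpaceIsConfiguration I G
lemma4p4 p l I _ G 1<|G| k orbit-of-size-k coprime quotient =
  <-irrefl (sym |G|≡1) 1<|G|
  where
    open Actions I
    open Subgroup G

    semi : Semiregular
    semi = semiregular-from-sides (OrbitSpaceIsConfiguration.semiregular quotient)

    divides-orbit-size : (∃ λ x → HasSize (AutOrbitP I x) k) ⊎ (∃ λ j → HasSize (AutOrbitL I j) k) →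
                         order G ∣ k
    divides-orbit-size (inj₁ (x , size)) = order-divides-aut-orbit semi points x k size
    divides-orbit-size (inj₂ (j , size)) = order-divides-aut-orbit semi lines j k size

    |G|≡1 : order G ≡ 1
    |G|≡1 = coprime (divides-orbit-size orbit-of-size-k , ∣-refl)
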